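{- If the statement $\Phi_5$ holds, then there are infinitely many positive integers $m$ such that $m!-1$ is prime.
   Context: Define $f:\{1,2,3,\ldots\}\to\mathbb{N}$ by $f(1)=2$, $f(2)=3$, and $f(n+1)=f(n)!$ for every integer $n\geqslant 2$. Write $x\not\mid y$ to mean that $x$ does not divide $y$. For a positive integer $n$, $\Phi_n$ denotes the statement: for every system $\mathcal{S}$ that is a subset of $\{x_i+1=x_k,\ x_i!=x_k,\ x_i\not\mid x_k : i,k\in\{1,\ldots,n\}\}$, if $\mathcal{S}$ has only finitely many solutions in positive integers $x_1,\ldots,x_n$, then every such solution $(x_1,\ldots,x_n)$ satisfies $x_1,\ldots,x_n\leqslant f(n)$. -}

module Defs where

open import Data.Nat using (ℕ; zero; suc; _≤_; _∸_; _!)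
open import Data.Nat.Divisibility using (_∤_)
open import Data.Nat.Primality using (Prime)
open import Data.Fin using (Fin)
open import Data.Vec using (Vec; lookup)
open import Data.List using (List)
open import Data.List.Membership.Propositional using (_∈_)
open import Data.List.Relation.Unary.All using (All)
open import Data.Product using (∃; _×_)
open import Relation.Binary.PropositionalEquality using (_≡_)
open import Relation.Nullary using (¬_)

-- f(1) = 2, f(2) = 3, f(n+1) = f(n)! for n ≥ 2.  (f 0 is an unused dummy value.)
f : ℕ → ℕ
f zero = 2
f (suc zero) = 2
f (suc (suc zero)) = 3
f (suc (suc (suc n))) = f (suc (suc n)) !

data Equation (n : ℕ) : Set where
  plus1 : Fin n → Fin n → Equation n
  fact  : Fin n → Fin n → Equation n
  ndiv  : Fin n → Fin n → Equation n

System : ℕ → Set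
System n = List (Equation n)

Holds : ∀ {n} → Vec ℕ n → Equation n → Set
Holds x (plus1 i k) = suc (lookup x i) ≡ lookup x k
Holds x (fact i k)  = lookup x i ! ≡ lookup x k
Holds x (ndiv i k)  = lookup x i ∤ lookup x k

Positive : ∀ {n} → Vec ℕ n → Set
Positive x = All (λ xi → 1 ≤ xi) (Data.Vec.toList x)

IsSolution : ∀ {n} → System n → Vec ℕ n → Set
IsSolution S x = Positive x × All (Holds x) S

Finite : {A : Set} → (A → Set) → Set
Finite {A} P = ∃ λ (L : List A) → ∀ a → P a → a ∈ L

Φ : ℕ → Set
Φ n = (S : System n) → Finite (IsSolution S) →
      ∀ x → IsSolution S x → All (λ xi → xi ≤ f n) (Data.Vec.toList x)

FactMinusOnePrime : ℕ → Set
FactMinusOnePrime m = 1 ≤ m × Prime (m ! ∸ 1)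

module Submission where

-- Consider the system over x₁,…,x₅
--     x₁! = x₂,   x₃ + 1 = x₂,   x₄ + 1 = x₃,   x₄! = x₅,   x₃ ∤ x₅ .
-- Its solutions are exactly x = (a, a!, a!-1, a!-2, (a!-2)!) with
-- a!-1 ∤ (a!-2)!.  By the converse direction of Wilson's theorem
-- (an integer p > 1 with p ≠ 4 not dividing (p-1)! is prime, since a
-- composite p ≠ 4 is a product of two factors that occur in (p-1)!),
-- every solution has a!-1 prime.  Hence if only finitely many a have
-- a!-1 prime, the system has finitely many solutions, and Φ₅ bounds them
-- by f 5 = 720!.  But a = 7 gives a solution (7!-1 = 5039 is prime)
-- whose last entry is 5038! > 720!, a contradiction.

open import Defs
open import Relation.Nullary using (¬_; Dec; yes; no; contradiction)

open import Data.Nat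
open import Data.Nat.Properties
open import Data.Nat.Divisibility
open import Data.Nat.Primality using (Prime; Composite; composite; ¬composite⇒prime)
open import Data.Fin using (Fin) renaming (zero to #0; suc to #suc)
open import Data.Vec using (Vec; _∷_; []; head)
open import Data.List using (map) renaming (_∷_ to _∷ₗ_; [] to []ₗ)
open import Data.List.Relation.Unary.All using () renaming (_∷_ to _∷ᵃ_; [] to []ᵃ)
open import Data.List.Membership.Propositional using (_∈_)
open import Data.List.Membership.Propositional.Properties using (∈-map⁺)
open import Data.Product using (_,_; _×_)
open import Relation.Binary using (tri<; tri≈; tri>)
open import Relation.Binary.PropositionalEquality
open import Relation.Nullary.Decidable using (from-no)

m∣n! : ∀ {m n} → 1 ≤ m → m ≤ n → m ∣ n !
m∣n! {suc m} _ m≤n = ∣-trans (m∣m*n (m !)) (m≤n⇒m!∣n! m≤n)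

-- Two distinct factors 1 ≤ m < n ≤ k of k! divide it jointly:
-- m ∣ (n-1)!, so m * n ∣ (n-1)! * n = n!, which divides k!.
m*n∣k! : ∀ {m n k} → 1 ≤ m → m < n → n ≤ k → m * n ∣ k !
m*n∣k! {m} {suc n} 1≤m (s≤s m≤n) n≤k = ∣-trans m*n∣n! (m≤n⇒m!∣n! n≤k)
  where
  m*n∣n! : m * suc n ∣ suc n !
  m*n∣n! = subst (_∣ suc n !) (*-comm (suc n) m) (*-monoʳ-∣ (suc n) (m∣n! 1≤m m≤n))

distinct-factors∣k! : ∀ {m n k} → 1 ≤ m → 1 ≤ n → m ≢ n → m ≤ k → n ≤ k → m * n ∣ k !
distinct-factors∣k! {m} {n} {k} 1≤m 1≤n m≢n m≤k n≤k with <-cmp m n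
... | tri< m<n _ _ = m*n∣k! 1≤m m<n n≤k
... | tri≈ _ m≡n _ = contradiction m≡n m≢n
... | tri> _ _ n<m = subst (_∣ k !) (*-comm n m) (m*n∣k! 1≤n n<m m≤k)

-- A square d * d divides k! once 2d ≤ k, because then d * (2d) ∣ k!.
square∣k! : ∀ {d k} → 1 ≤ d → 2 * d ≤ k → d * d ∣ k !
square∣k! {d} {k} 1≤d 2d≤k = ∣-trans (*-monoʳ-∣ d (n∣m*n 2)) (m*n∣k! 1≤d d<2d 2d≤k)
  where
  d<2d : d < 2 * d
  d<2d = subst (d <_) (cong (d +_) (sym (+-identityʳ d))) (m<m+n d 1≤d)

-- For d ≥ 3 the square d * d exceeds 2d; this excludes p = 4 from
-- the square case below.
2d<d*d : ∀ {d} → 3 ≤ d → 2 * d < d * d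
2d<d*d {d@(suc _)} 3≤d = begin-strict
  2 * d ≡⟨ *-comm 2 d ⟩
  d * 2 <⟨ *-monoʳ-< d (s≤s (s≤s (s≤s z≤n))) ⟩
  d * 3 ≤⟨ *-monoʳ-≤ d 3≤d ⟩
  d * d ∎
  where open ≤-Reasoning

square≢4⇒3≤ : ∀ d → 1 < d → d * d ≢ 4 → 3 ≤ d
square≢4⇒3≤ (suc zero) (s≤s ()) _
square≢4⇒3≤ (suc (suc zero))    _ d*d≢4 = contradiction refl d*d≢4
square≢4⇒3≤ (suc (suc (suc _))) _ _     = s≤s (s≤s (s≤s z≤n))

-- A composite number p = k + 1 other than 4 divides k! = (p-1)!.
-- Write p = d * q with 1 < d, q < p: if d ≠ q both are distinct factors
-- of k!; if d = q then d ≥ 3 (as p ≠ 4) and 2d < d * d = p.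
composite∣factorial : ∀ {k} → Composite (suc k) → suc k ≢ 4 → suc k ∣ k !
composite∣factorial {k} (composite {d} d<p d∣p) p≢4 =
  subst (_∣ k !) (sym p≡d*q) (product∣k! (d ≟ q))
  where
  q : ℕ
  q = quotient d∣p
  p≡d*q : suc k ≡ d * q
  p≡d*q = m∣n⇒n≡m*quotient d∣p
  1<d : 1 < d
  1<d = nonTrivial⇒n>1 d
  1<q : 1 < q
  1<q = quotient>1 d∣p d<p
  q<p : q < suc k
  q<p = quotient-< d∣p
  product∣k! : Dec (d ≡ q) → d * q ∣ k !
  product∣k! (no d≢q) =
    distinct-factors∣k! (<⇒≤ 1<d) (<⇒≤ 1<q) d≢q (≤-pred d<p) (≤-pred q<p)
  product∣k! (yes refl) = square∣k! (<⇒≤ 1<d) (≤-pred 2d<p)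
    where
    3≤d : 3 ≤ d
    3≤d = square≢4⇒3≤ d 1<d (λ d*d≡4 → p≢4 (trans p≡d*q d*d≡4))
    2d<p : 2 * d < suc k
    2d<p = subst (2 * d <_) (sym p≡d*q) (2d<d*d 3≤d)

∤factorial⇒prime : ∀ {k} → 1 ≤ k → suc k ≢ 4 → suc k ∤ k ! → Prime (suc k)
∤factorial⇒prime {suc k} _ p≢4 p∤k! =
  ¬composite⇒prime {{n>1⇒nonTrivial (s≤s (s≤s z≤n))}}
    (λ p-composite → p∤k! (composite∣factorial p-composite p≢4))

-- No factorial equals 5 (needed to rule out a! - 1 = 4).
n!≢5 : ∀ n → n ! ≢ 5
n!≢5 0 ()
n!≢5 1 ()
n!≢5 2 ()
n!≢5 n@(suc (suc (suc _))) n!≡5 = from-no (6 ∣? 5) (subst (6 ∣_) n!≡5 6∣n!)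
  where
  6∣n! : 6 ∣ n !
  6∣n! = m≤n⇒m!∣n! {3} {n} (s≤s (s≤s (s≤s z≤n)))

x₁ x₂ x₃ x₄ x₅ : Fin 5
x₁ = #0
x₂ = #suc #0
x₃ = #suc (#suc #0)
x₄ = #suc (#suc (#suc #0))
x₅ = #suc (#suc (#suc (#suc #0)))

system : System 5
system = fact x₁ x₂ ∷ₗ plus1 x₃ x₂ ∷ₗ plus1 x₄ x₃ ∷ₗ fact x₄ x₅ ∷ₗ ndiv x₃ x₅ ∷ₗ []ₗ

solutionOf : ℕ → Vec ℕ 5
solutionOf a = a ∷ a ! ∷ a ! ∸ 1 ∷ a ! ∸ 2 ∷ (a ! ∸ 2) ! ∷ []

-- Every solution is the candidate determined by its first entry a, and
-- then a! - 1 is prime: with x₄ = d we have a! = d + 2 and d + 1 ∤ d!.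
solution-analysis : ∀ x → IsSolution system x →
                    FactMinusOnePrime (head x) × x ≡ solutionOf (head x)
solution-analysis (a ∷ _ ∷ _ ∷ d ∷ _ ∷ [])
                  ((1≤a ∷ᵃ _ ∷ᵃ _ ∷ᵃ 1≤d ∷ᵃ _ ∷ᵃ []ᵃ) ,
                   (refl ∷ᵃ d+2≡a! ∷ᵃ refl ∷ᵃ refl ∷ᵃ d+1∤d! ∷ᵃ []ᵃ)) =
  (1≤a , subst (λ n → Prime (n ∸ 1)) d+2≡a! d+1-prime) , shape
  where
  d+1-prime : Prime (suc d)
  d+1-prime = ∤factorial⇒prime 1≤d (λ d+1≡4 → n!≢5 a (trans (sym d+2≡a!) (cong suc d+1≡4))) d+1∤d!
  shape : a ∷ a ! ∷ suc d ∷ d ∷ d ! ∷ [] ≡ solutionOf a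
  shape rewrite sym d+2≡a! = refl

-- If only finitely many a have a! - 1 prime, the system has only
-- finitely many solutions: they are among the candidates for those a.
finitely-many-solutions : Finite FactMinusOnePrime → Finite (IsSolution system)
finitely-many-solutions (L , L-covers) = map solutionOf L , covers
  where
  covers : ∀ x → IsSolution system x → x ∈ map solutionOf L
  covers x x-solves with solution-analysis x x-solves
  ... | a!-1-prime , x≡solution = subst (_∈ map solutionOf L) (sym x≡solution)
                                        (∈-map⁺ solutionOf (L-covers (head x) a!-1-prime))

-- a = 7 gives a solution, since 7! - 1 = 5039 does not divide 5038!
-- (5039 is prime); this divisibility is checked by computation.
solution-7 : IsSolution system (solutionOf 7)
solution-7 = (s≤s z≤n ∷ᵃ s≤s z≤n ∷ᵃ s≤s z≤n ∷ᵃ s≤s z≤n ∷ᵃ 1≤n! 5038 ∷ᵃ []ᵃ) ,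
             (refl ∷ᵃ refl ∷ᵃ refl ∷ᵃ refl ∷ᵃ from-no (5039 ∣? 5038 !) ∷ᵃ []ᵃ)

-- Φ₅ and finitely many primes of the form m! - 1 would bound the last
-- entry 5038! of that solution by f 5 = 720!, which is false.
theorem2 : Φ 5 → ¬ Finite FactMinusOnePrime
theorem2 Φ₅ finite with Φ₅ system (finitely-many-solutions finite) (solutionOf 7) solution-7
... | _ ∷ᵃ _ ∷ᵃ _ ∷ᵃ _ ∷ᵃ 5038!≤f5 ∷ᵃ []ᵃ = from-no (5038 ! ≤? f 5) 5038!≤f5
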